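{- Let $n\in\{2,3,4\}$ and let $G$ be a graph on $2n+1$ vertices with at least $n^2+n$ edges such that $G$ contains no two distinct vertices of equal degree joined by a path of length three. Let $\beta$ be the largest integer such that $G$ contains two distinct vertices of degree $\beta$, and suppose $\beta\le n$. Then the maximum degree $\Delta$ of $G$ satisfies $\Delta\le 2n-2$.
   Context: Graphs are finite and simple. A path of length three joining $a$ and $b$ is a path $a\,x\,y\,b$ on four distinct vertices with three edges. -}

module Defs where

open import Data.Nat using (ℕ; zero; suc; _+_; _<ᵇ_)
open import Data.Fin using (Fin; toℕ) renaming (zero to fz; suc to fs)
open import Data.Bool using (Bool; true; false; if_then_else_; _∧_; T)
open import Data.Product using (Σ; _×_)
open import Relation.Binary.PropositionalEquality using (_≡_; _≢_)

record Graph (V : ℕ) : Set where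
  field
    adj    : Fin V → Fin V → Bool
    sym    : ∀ i j → adj i j ≡ adj j i
    irrefl : ∀ i → adj i i ≡ false

open Graph public

countTrue : (m : ℕ) → (Fin m → Bool) → ℕ
countTrue zero    f = 0
countTrue (suc m) f = (if f fz then 1 else 0) + countTrue m (λ k → f (fs k))

degree : ∀ {V} → Graph V → Fin V → ℕ
degree {V} G v = countTrue V (adj G v)

edgeCount : ∀ {V} → Graph V → ℕ
edgeCount {V} G = sumOver V (λ i → countTrue V (λ j → (toℕ i <ᵇ toℕ j) ∧ adj G i j))
  where
    sumOver : (m : ℕ) → (Fin m → ℕ) → ℕ
    sumOver zero    f = 0
    sumOver (suc m) f = f fz + sumOver m (λ k → f (fs k))

PathOfLength3 : ∀ {V} → Graph V → Fin V → Fin V → Set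
PathOfLength3 {V} G a b =
  Σ (Fin V) λ x → Σ (Fin V) λ y →
    (a ≢ x) × (a ≢ y) × (a ≢ b) × (x ≢ y) × (x ≢ b) × (y ≢ b) ×
    T (adj G a x) × T (adj G x y) × T (adj G y b)

-- A vertex of degree 2n is adjacent to all others; if there is none, a vertex of degree 2n − 1
-- is adjacent to all others but one, w. Call it the hub h; by β ≤ n its degree, like every
-- degree above n, occurs only once. If a ≠ h and b ∉ {h, w} have equal degree, every neighbour
-- x of a other than h and w is b, since otherwise a x h b is a path of length three. Hence
-- repeated degrees are at most 2 (resp. 3), and a degree class lies in {a, x, w} for any of its
-- members a and any neighbour x ∉ {h, w} of a. Summing degrees by value then gives less than
-- 2(n² + n), contradicting the handshake lemma. For n = 2 a full hub also rules out degree 3: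
-- two neighbours other than h of such a vertex would be twins of degree 2.
module Submission where
open import Defs hiding (sym)
open import Data.Nat using (ℕ; zero; suc; _+_; _*_; _∸_; _≤_; _<_; z≤n; s≤s; s≤s⁻¹; _<ᵇ_; _≡ᵇ_)
open import Data.Nat.Properties
open import Algebra.Properties.CommutativeSemigroup +-commutativeSemigroup using (x∙yz≈y∙xz)
open import Algebra.Properties.Semiring.Sum +-*-semiring
  using (sum; sum-syntax; sum-cong-≗; sum-replicate-zero; ∑-distrib-+; ∑-comm; *-distribˡ-sum)
open import Data.Fin using (Fin; toℕ) renaming (zero to fz; suc to fs)
open import Data.Fin.Properties using (any?; toℕ-injective) renaming (_≟_ to _≟ᶠ_)
open import Data.Bool using (Bool; true; false; if_then_else_; _∧_; not; T)
open import Data.Bool.Properties using (∧-identityʳ; ∧-zeroʳ; T?)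
open import Data.List using (List; []; _∷_; length)
open import Data.List.Membership.Propositional using (_∈_; _∉_)
open import Data.List.Relation.Unary.Any using (here; there)
open import Data.List.Relation.Unary.All as All using (All; []; _∷_)
open import Data.List.Relation.Unary.Any.Properties using (¬Any[])
open import Data.List.Relation.Unary.All.Properties using (¬Any⇒All¬)
import Data.List.Membership.DecPropositional as DecMembership
open import Data.List.Relation.Unary.Unique.Propositional using (Unique; []; _∷_)
open import Data.Product using (Σ; ∃-syntax; _×_; _,_; proj₂)
open import Data.Sum using (_⊎_; inj₁; inj₂)
open import Data.Empty using (⊥-elim)
open import Data.Unit using (tt)
open import Function using (_∘_)
open import Relation.Nullary using (¬_; yes; no; does; contradiction)
open import Relation.Binary.PropositionalEquality
  using (_≡_; _≢_; refl; sym; trans; cong; cong₂; subst; module ≡-Reasoning)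

indicator : Bool → ℕ
indicator b = if b then 1 else 0

indicator≤1 : ∀ b → indicator b ≤ 1
indicator≤1 true  = s≤s z≤n
indicator≤1 false = z≤n

sum-mono-≤ : ∀ {n} {f g : Fin n → ℕ} → (∀ i → f i ≤ g i) → sum f ≤ sum g
sum-mono-≤ {zero}  f≤g = z≤n
sum-mono-≤ {suc n} f≤g = +-mono-≤ (f≤g fz) (sum-mono-≤ (f≤g ∘ fs))

sum-const-1 : ∀ n → ∑[ i < n ] 1 ≡ n
sum-const-1 zero    = refl
sum-const-1 (suc n) = cong suc (sum-const-1 n)

sum-select : ∀ L (f : ℕ → ℕ) n → n < L →
             ∑[ x < L ] (f (toℕ x) * indicator (n ≡ᵇ toℕ x)) ≡ f n
sum-select (suc L) f zero    _ = trans (cong₂ _+_ (*-identityʳ (f 0)) rest) (+-identityʳ (f 0))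
  where
  rest : ∑[ x < L ] (f (suc (toℕ x)) * 0) ≡ 0
  rest = trans (sum-cong-≗ {L} (λ x → *-zeroʳ (f (suc (toℕ x))))) (sum-replicate-zero L)
sum-select (suc L) f (suc n) (s≤s n<L) =
  cong₂ _+_ (*-zeroʳ (f 0)) (sum-select L (f ∘ suc) n n<L)

countTrue≡sum : ∀ m (p : Fin m → Bool) → countTrue m p ≡ ∑[ i < m ] indicator (p i)
countTrue≡sum zero    p = refl
countTrue≡sum (suc m) p = cong (indicator (p fz) +_) (countTrue≡sum m (p ∘ fs))

multiplicity : ∀ {V} → (Fin V → ℕ) → ℕ → ℕ
multiplicity {V} d x = countTrue V (λ i → d i ≡ᵇ x)

weighted-split : ∀ x K c b → (K < x → c ≤ b) → x * c ≤ K * c + (x ∸ K) * b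
weighted-split x K c b c≤b with x ≤? K
... | yes x≤K rewrite m≤n⇒m∸n≡0 x≤K = ≤-trans (*-monoˡ-≤ c x≤K) (m≤m+n (K * c) 0)
... | no  x≰K = begin
  x * c                   ≤⟨ *-monoˡ-≤ c (m≤n+m∸n x K) ⟩
  (K + (x ∸ K)) * c       ≡⟨ *-distribʳ-+ c K (x ∸ K) ⟩
  K * c + (x ∸ K) * c     ≤⟨ +-monoʳ-≤ (K * c) (*-monoʳ-≤ (x ∸ K) (c≤b (≰⇒> x≰K))) ⟩
  K * c + (x ∸ K) * b     ∎
  where open ≤-Reasoning

-- Grouping the sum by values: values up to K are charged K each, and a value x > K
-- contributes its excess x ∸ K once for each of its at most b x occurrences.
sum≤multiplicities : ∀ {V} (d : Fin V → ℕ) L K (b : ℕ → ℕ) → (∀ i → d i < L) →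
  (∀ x → K < x → multiplicity d x ≤ b x) →
  ∑[ i < V ] d i ≤ K * V + ∑[ x < L ] ((toℕ x ∸ K) * b (toℕ x))
sum≤multiplicities {V} d L K b d<L mult≤ = begin
  ∑[ i < V ] d i
    ≡⟨ sum-cong-≗ (λ i → sym (sum-select L (λ x → x) (d i) (d<L i))) ⟩
  ∑[ i < V ] ∑[ x < L ] (toℕ x * [ i ≡ x ])
    ≡⟨ ∑-comm (λ i x → toℕ x * [ i ≡ x ]) ⟩
  ∑[ x < L ] ∑[ i < V ] (toℕ x * [ i ≡ x ])
    ≡⟨ sum-cong-≗ (λ x → sym (*-distribˡ-sum (toℕ x) (λ i → [ i ≡ x ]))) ⟩
  ∑[ x < L ] (toℕ x * count x)
    ≤⟨ sum-mono-≤ (λ x → weighted-split (toℕ x) K (count x) (b (toℕ x))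
         (subst (_≤ b (toℕ x)) (countTrue≡sum V _) ∘ mult≤ (toℕ x))) ⟩
  ∑[ x < L ] (K * count x + (toℕ x ∸ K) * b (toℕ x))
    ≡⟨ ∑-distrib-+ (λ x → K * count x) (λ x → (toℕ x ∸ K) * b (toℕ x)) ⟩
  ∑[ x < L ] (K * count x) + ∑[ x < L ] ((toℕ x ∸ K) * b (toℕ x))
    ≡⟨ cong (_+ ∑[ x < L ] ((toℕ x ∸ K) * b (toℕ x)))
            (trans (sym (*-distribˡ-sum K count)) (cong (K *_) total)) ⟩
  K * V + ∑[ x < L ] ((toℕ x ∸ K) * b (toℕ x))  ∎
  where
  open ≤-Reasoning
  [_≡_] : Fin V → Fin L → ℕ
  [ i ≡ x ] = indicator (d i ≡ᵇ toℕ x)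
  count : Fin L → ℕ
  count x = ∑[ i < V ] [ i ≡ x ]
  total : ∑[ x < L ] count x ≡ V
  total = begin-equality
    ∑[ x < L ] ∑[ i < V ] [ i ≡ x ]
      ≡⟨ ∑-comm (λ x i → [ i ≡ x ]) ⟩
    ∑[ i < V ] ∑[ x < L ] [ i ≡ x ]
      ≡⟨ sum-cong-≗ (λ i → sum-cong-≗ (λ x → sym (*-identityˡ [ i ≡ x ]))) ⟩
    ∑[ i < V ] ∑[ x < L ] (1 * [ i ≡ x ])
      ≡⟨ sum-cong-≗ (λ i → sum-select L (λ _ → 1) (d i) (d<L i)) ⟩
    ∑[ i < V ] 1
      ≡⟨ sum-const-1 V ⟩
    V ∎

_without_ : ∀ {m} → (Fin m → Bool) → Fin m → Fin m → Bool
(p without i) j = p j ∧ not (does (j ≟ᶠ i))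

T-without : ∀ {m} {p : Fin m → Bool} {i j} → T ((p without i) j) → T (p j) × j ≢ i
T-without {p = p} {i} {j} t with j ≟ᶠ i
... | yes _    rewrite ∧-zeroʳ (p j)     = ⊥-elim t
... | no  j≢i  rewrite ∧-identityʳ (p j) = t , j≢i

without-T : ∀ {m} {p : Fin m → Bool} {i j} → T (p j) → j ≢ i → T ((p without i) j)
without-T {p = p} {i} {j} pj j≢i with j ≟ᶠ i
... | yes j≡i = contradiction j≡i j≢i
... | no  _   rewrite ∧-identityʳ (p j) = pj

indicator-T : ∀ {b} → T b → indicator b ≡ 1
indicator-T {true} _ = refl

T-not : ∀ {b} → ¬ T b → T (not b)
T-not {true}  ¬t = ¬t tt
T-not {false} _  = tt

countTrue-ext : ∀ m {p q : Fin m → Bool} → (∀ k → p k ≡ q k) → countTrue m p ≡ countTrue m q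
countTrue-ext zero    p≗q = refl
countTrue-ext (suc m) p≗q = cong₂ _+_ (cong indicator (p≗q fz)) (countTrue-ext m (p≗q ∘ fs))

countTrue-remove : ∀ m (p : Fin m → Bool) i →
                   countTrue m p ≡ indicator (p i) + countTrue m (p without i)
countTrue-remove (suc m) p fz = cong (indicator (p fz) +_) (sym (cong₂ _+_
  (cong indicator (∧-zeroʳ (p fz))) (countTrue-ext m (λ k → ∧-identityʳ (p (fs k))))))
countTrue-remove (suc m) p (fs i) = begin
  indicator (p fz) + countTrue m (p ∘ fs)
    ≡⟨ cong (indicator (p fz) +_) (countTrue-remove m (p ∘ fs) i) ⟩
  indicator (p fz) + (indicator (p (fs i)) + countTrue m ((p ∘ fs) without i))
    ≡⟨ x∙yz≈y∙xz (indicator (p fz)) (indicator (p (fs i))) (countTrue m ((p ∘ fs) without i)) ⟩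
  indicator (p (fs i)) + (indicator (p fz) + countTrue m ((p ∘ fs) without i))
    ≡⟨ cong (λ b → indicator (p (fs i)) + (indicator b + countTrue m ((p ∘ fs) without i)))
            (sym (∧-identityʳ (p fz))) ⟩
  indicator (p (fs i)) + countTrue (suc m) (p without fs i)  ∎
  where open ≡-Reasoning

countTrue≤suc-without : ∀ m (p : Fin m → Bool) i → countTrue m p ≤ suc (countTrue m (p without i))
countTrue≤suc-without m p i =
  ≤-trans (≤-reflexive (countTrue-remove m p i)) (+-monoˡ-≤ _ (indicator≤1 (p i)))

countTrue-none : ∀ m (p : Fin m → Bool) → (∀ i → ¬ T (p i)) → countTrue m p ≡ 0
countTrue-none zero    p none = refl
countTrue-none (suc m) p none with p fz | none fz
... | true  | ¬t = contradiction tt ¬t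
... | false | _  = countTrue-none m (p ∘ fs) (none ∘ fs)

countTrue-witness : ∀ m (p : Fin m → Bool) → 0 < countTrue m p → ∃[ i ] T (p i)
countTrue-witness m p 0<c with any? (λ i → T? (p i))
... | yes found = found
... | no  none  = contradiction (countTrue-none m p (λ i t → none (i , t))) (n>0⇒n≢0 0<c)

countTrue≤-byWitness : ∀ m (p : Fin m → Bool) k →
                       (∀ i → T (p i) → countTrue m p ≤ k) → countTrue m p ≤ k
countTrue≤-byWitness m p k bound with any? (λ i → T? (p i))
... | yes (i , pi) = bound i pi
... | no  none rewrite countTrue-none m p (λ i t → none (i , t)) = z≤n

countTrue-compl : ∀ m (p : Fin m → Bool) → countTrue m p + countTrue m (not ∘ p) ≡ m
countTrue-compl zero    p = refl
countTrue-compl (suc m) p with p fz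
... | true  = cong suc (countTrue-compl m (p ∘ fs))
... | false = trans (+-suc _ _) (cong suc (countTrue-compl m (p ∘ fs)))

countTrue≤length : ∀ m (p : Fin m → Bool) xs → (∀ i → T (p i) → i ∈ xs) → countTrue m p ≤ length xs
countTrue≤length m p []       ⊆[] = ≤-reflexive (countTrue-none m p (λ i → ¬Any[] ∘ ⊆[] i))
countTrue≤length m p (x ∷ xs) ⊆x∷xs = ≤-trans (countTrue≤suc-without m p x)
  (s≤s (countTrue≤length m (p without x) xs ⊆xs))
  where
  ⊆xs : ∀ i → T ((p without x) i) → i ∈ xs
  ⊆xs i t with T-without {p = p} t
  ... | pi , i≢x with ⊆x∷xs i pi
  ...   | here  i≡x  = contradiction i≡x i≢x
  ...   | there i∈xs = i∈xs

length≤countTrue : ∀ m (p : Fin m → Bool) {xs} → Unique xs → All (T ∘ p) xs → length xs ≤ countTrue m p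
length≤countTrue m p []              []         = z≤n
length≤countTrue m p {x ∷ xs} (x≢xs ∷ unique) (px ∷ pxs) = begin
  suc (length xs)                             ≤⟨ s≤s (length≤countTrue m (p without x) unique pxs′) ⟩
  1 + countTrue m (p without x)               ≡⟨ cong (_+ countTrue m (p without x)) (sym (indicator-T px)) ⟩
  indicator (p x) + countTrue m (p without x) ≡⟨ sym (countTrue-remove m p x) ⟩
  countTrue m p                               ∎
  where
  open ≤-Reasoning
  pxs′ : All (T ∘ (p without x)) xs
  pxs′ = All.zipWith (λ (py , x≢y) → without-T {p = p} py (x≢y ∘ sym)) (pxs , x≢xs)

∃-outside : ∀ m (p : Fin m → Bool) xs → length xs < countTrue m p → ∃[ i ] T (p i) × i ∉ xs
∃-outside m p [] 0<c with countTrue-witness m p 0<c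
... | i , pi = i , pi , λ ()
∃-outside m p (x ∷ xs) |x∷xs|<c
  with ∃-outside m (p without x) xs (s≤s⁻¹ (≤-trans |x∷xs|<c (countTrue≤suc-without m p x)))
... | i , t , i∉xs with T-without {p = p} t
...   | pi , i≢x = i , pi , λ { (here i≡x) → i≢x i≡x ; (there i∈xs) → i∉xs i∈xs }

multiplicity≤length : ∀ {V} (d : Fin V → ℕ) x xs → (∀ a → d a ≡ x → a ∈ xs) →
                      multiplicity d x ≤ length xs
multiplicity≤length d x xs ⊆xs = countTrue≤length _ _ xs (λ a t → ⊆xs a (≡ᵇ⇒≡ (d a) x t))

multiplicity≤-byWitness : ∀ {V} (d : Fin V → ℕ) x k → (∀ a → d a ≡ x → multiplicity d x ≤ k) →
                          multiplicity d x ≤ k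
multiplicity≤-byWitness d x k bound = countTrue≤-byWitness _ _ k (λ a t → bound a (≡ᵇ⇒≡ (d a) x t))

module _ {V} (G : Graph V) where

  adj⇒≢ : ∀ {a b} → T (adj G a b) → a ≢ b
  adj⇒≢ {a} ab refl = subst T (irrefl G a) ab

  adj-sym : ∀ {a b} → T (adj G a b) → T (adj G b a)
  adj-sym {a} {b} = subst T (Graph.sym G a b)

  nonAdjacent-self : ∀ a → T (not (adj G a a))
  nonAdjacent-self a = T-not (subst T (irrefl G a))

  degree+nonDegree : ∀ a → degree G a + countTrue V (not ∘ adj G a) ≡ V
  degree+nonDegree a = countTrue-compl V (adj G a)

  degree<V : ∀ a → degree G a < V
  degree<V a = begin-strict
    degree G a                                   <⟨ m<m+n (degree G a) self ⟩
    degree G a + countTrue V (not ∘ adj G a)     ≡⟨ degree+nonDegree a ⟩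
    V                                            ∎
    where
    open ≤-Reasoning
    self : 0 < countTrue V (not ∘ adj G a)
    self = length≤countTrue V (not ∘ adj G a) ([] ∷ []) (nonAdjacent-self a ∷ [])

  adjacent-outside : ∀ h ys → Unique (h ∷ ys) → All (λ y → T (not (adj G h y))) ys →
                     V ≤ suc (length ys) + degree G h → ∀ y → y ≢ h → y ∉ ys → T (adj G h y)
  adjacent-outside h ys (h∉ys ∷ unique) nonAdj V≤ y y≢h y∉ys with T? (adj G h y)
  ... | yes hy = hy
  ... | no ¬hy = contradiction V≤ (<⇒≱ (begin-strict
    suc (length ys) + degree G h                  <⟨ n<1+n _ ⟩
    2 + length ys + degree G h                    ≡⟨ +-comm (2 + length ys) (degree G h) ⟩
    degree G h + (2 + length ys)                  ≤⟨ +-monoʳ-≤ (degree G h) nonNeighbours ⟩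
    degree G h + countTrue V (not ∘ adj G h)      ≡⟨ degree+nonDegree h ⟩
    V                                             ∎))
    where
    open ≤-Reasoning
    nonNeighbours : 2 + length ys ≤ countTrue V (not ∘ adj G h)
    nonNeighbours = length≤countTrue V (not ∘ adj G h) {h ∷ y ∷ ys}
      (((y≢h ∘ sym) ∷ h∉ys) ∷ ¬Any⇒All¬ ys y∉ys ∷ unique)
      (nonAdjacent-self h ∷ T-not ¬hy ∷ nonAdj)

degree<-of-noFullVertex : ∀ {k} (G : Graph (suc k)) → ¬ (∃[ u ] degree G u ≡ k) → ∀ i → degree G i < k
degree<-of-noFullVertex G noFull i = ≤∧≢⇒< (s≤s⁻¹ (degree<V G i)) (λ di → noFull (i , di))

adjacent-to-all : ∀ {k} (G : Graph (suc k)) u → degree G u ≡ k →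
                  ∀ y → y ≢ u → y ∉ [] → T (adj G u y)
adjacent-to-all G u du = adjacent-outside G u [] ([] ∷ []) [] (≤-reflexive (cong suc (sym du)))

adjacent-to-all-but-one : ∀ {k} (G : Graph (suc (suc k))) v → degree G v ≡ k →
                          ∃[ w ] ∀ y → y ≢ v → y ∉ w ∷ [] → T (adj G v y)
adjacent-to-all-but-one {k} G v dv with ∃-outside _ (not ∘ adj G v) (v ∷ []) two
  where
  two : 1 < countTrue (suc (suc k)) (not ∘ adj G v)
  two = ≤-reflexive (sym (+-cancelˡ-≡ k _ 2 (trans (cong (_+ countTrue _ (not ∘ adj G v)) (sym dv))
          (trans (degree+nonDegree G v) (+-comm 2 k)))))
... | w , nonAdj , w∉[v] = w , adjacent-outside G v (w ∷ [])
  (((λ v≡w → w∉[v] (here (sym v≡w))) ∷ []) ∷ [] ∷ []) (nonAdj ∷ [])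
  (≤-reflexive (cong (2 +_) (sym dv)))

EqualDegreePath3Free : ∀ {V} → Graph V → Set
EqualDegreePath3Free G = ∀ a b → a ≢ b → degree G a ≡ degree G b → ¬ PathOfLength3 G a b

RepeatedDegreesAtMost : ∀ {V} → Graph V → ℕ → Set
RepeatedDegreesAtMost G n = ∀ a b → a ≢ b → degree G a ≡ degree G b → degree G a ≤ n

module _ {V} (G : Graph V) {n} (repeated≤ : RepeatedDegreesAtMost G n) where

  degree-unique : ∀ {a} → n < degree G a → ∀ c → degree G c ≡ degree G a → c ≡ a
  degree-unique {a} n<da c same with c ≟ᶠ a
  ... | yes c≡a = c≡a
  ... | no  c≢a = contradiction (repeated≤ c a c≢a same) (<⇒≱ (subst (n <_) (sym same) n<da))

  multiplicity≤1 : ∀ δ → n < δ → multiplicity (degree G) δ ≤ 1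
  multiplicity≤1 δ n<δ = multiplicity≤-byWitness (degree G) δ 1 λ a da →
    multiplicity≤length (degree G) δ (a ∷ [])
      (λ c dc → here (degree-unique (subst (n <_) (sym da) n<δ) c (trans dc (sym da))))

module Hub {V} (G : Graph V) (path3Free : EqualDegreePath3Free G)
           (h : Fin V) (ys : List (Fin V))
           (hub-adj : ∀ y → y ≢ h → y ∉ ys → T (adj G h y))
           (hub-unique : ∀ c → degree G c ≡ degree G h → c ≡ h) where

  open DecMembership (_≟ᶠ_ {V}) using (_∈?_)

  hub-class : ∀ {a} → a ≡ h → ∀ c → degree G c ≡ degree G a → c ≡ a
  hub-class refl c same = hub-unique c same

  ≢hub : ∀ {a c} → a ≢ h → degree G c ≡ degree G a → c ≢ h
  ≢hub a≢h same c≡h = a≢h (hub-unique _ (trans (sym same) (cong (degree G) c≡h)))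

  -- Otherwise a x h b would be a path of length three between vertices of equal degree.
  twin-neighbour : ∀ {a b x} → a ≢ b → a ≢ h → b ≢ h → b ∉ ys → degree G a ≡ degree G b →
                   T (adj G a x) → x ≢ h → x ∉ ys → x ≡ b
  twin-neighbour {a} {b} {x} a≢b a≢h b≢h b∉ys same ax x≢h x∉ys with x ≟ᶠ b
  ... | yes x≡b = x≡b
  ... | no  x≢b = contradiction
    (x , h , adj⇒≢ G ax , a≢h , a≢b , x≢h , x≢b , b≢h ∘ sym ,
     ax , adj-sym G (hub-adj x x≢h x∉ys) , hub-adj b b≢h b∉ys)
    (path3Free a b a≢b same)

  twin-degree≤ : ∀ {a b} → a ≢ b → a ≢ h → b ≢ h → b ∉ ys → degree G a ≡ degree G b →
                 degree G a ≤ 2 + length ys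
  twin-degree≤ {a} {b} a≢b a≢h b≢h b∉ys same = countTrue≤length V (adj G a) (h ∷ b ∷ ys) neighbours
    where
    neighbours : ∀ x → T (adj G a x) → x ∈ h ∷ b ∷ ys
    neighbours x ax with x ≟ᶠ h
    ... | yes x≡h = here x≡h
    ... | no  x≢h with x ∈? ys
    ...   | yes x∈ys = there (there x∈ys)
    ...   | no  x∉ys = there (here (twin-neighbour a≢b a≢h b≢h b∉ys same ax x≢h x∉ys))

  sameDegree⊆ : ∀ a → 1 + length ys < degree G a →
                ∃[ x ] ∀ c → degree G c ≡ degree G a → c ∈ a ∷ x ∷ ys
  sameDegree⊆ a big with a ≟ᶠ h
  ... | yes a≡h = a , λ c same → here (hub-class a≡h c same)
  ... | no  a≢h with ∃-outside V (adj G a) (h ∷ ys) big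
  ...   | x , ax , x∉h∷ys = x , class
    where
    class : ∀ c → degree G c ≡ degree G a → c ∈ a ∷ x ∷ ys
    class c same with c ≟ᶠ a
    ... | yes c≡a = here c≡a
    ... | no  c≢a with c ∈? ys
    ...   | yes c∈ys = there (there c∈ys)
    ...   | no  c∉ys = there (here (sym (twin-neighbour (c≢a ∘ sym) a≢h (≢hub a≢h same) c∉ys (sym same)
                                          ax (x∉h∷ys ∘ here) (x∉h∷ys ∘ there))))

  sameDegree⊆′ : ∀ a → 2 + length ys < degree G a → ∀ c → degree G c ≡ degree G a → c ∈ a ∷ ys
  sameDegree⊆′ a big c same with a ≟ᶠ h
  ... | yes a≡h = here (hub-class a≡h c same)
  ... | no  a≢h with c ≟ᶠ a
  ...   | yes c≡a = here c≡a
  ...   | no  c≢a with c ∈? ys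
  ...     | yes c∈ys = there c∈ys
  ...     | no  c∉ys = contradiction
    (twin-degree≤ (c≢a ∘ sym) a≢h (≢hub a≢h same) c∉ys (sym same)) (<⇒≱ big)

  multiplicity≤2+length : ∀ δ → 1 + length ys < δ → multiplicity (degree G) δ ≤ 2 + length ys
  multiplicity≤2+length δ big = multiplicity≤-byWitness (degree G) δ _ λ a da →
    let x , class = sameDegree⊆ a (subst (1 + length ys <_) (sym da) big) in
    multiplicity≤length (degree G) δ (a ∷ x ∷ ys) (λ c dc → class c (trans dc (sym da)))

  multiplicity≤1+length : ∀ δ → 2 + length ys < δ → multiplicity (degree G) δ ≤ 1 + length ys
  multiplicity≤1+length δ big = multiplicity≤-byWitness (degree G) δ _ λ a da →
    multiplicity≤length (degree G) δ (a ∷ ys)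
      (λ c dc → sameDegree⊆′ a (subst (2 + length ys <_) (sym da) big) c (trans dc (sym da)))

module _ (G : Graph 5) (path3Free : EqualDegreePath3Free G) (repeated≤ : RepeatedDegreesAtMost G 2)
         (u : Fin 5) (du : degree G u ≡ 4) where

  private
    u-unique : ∀ c → degree G c ≡ degree G u → c ≡ u
    u-unique = degree-unique G repeated≤ (subst (2 <_) (sym du) (<ᵇ⇒< 2 4 tt))

  open Hub G path3Free u [] (adjacent-to-all G u du) u-unique

  private
    ≢u : ∀ {a} → degree G a ≡ 3 → a ≢ u
    ≢u da refl = contradiction (trans (sym da) du) (λ ())

    -- z is adjacent to u and a, cannot share degree 3 with a, nor degree 4 with u.
    neighbour-degree≡2 : ∀ {a z} → degree G a ≡ 3 → T (adj G a z) → z ≢ u → degree G z ≡ 2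
    neighbour-degree≡2 {a} {z} da az z≢u =
      ≤-antisym (s≤s⁻¹ (≤∧≢⇒< (s≤s⁻¹ (≤∧≢⇒< (s≤s⁻¹ (degree<V G z)) ≢4)) ≢3)) 2≤
      where
      2≤ : 2 ≤ degree G z
      2≤ = length≤countTrue 5 (adj G z) {u ∷ a ∷ []} (((≢u da ∘ sym) ∷ []) ∷ [] ∷ [])
             (adj-sym G (adjacent-to-all G u du z z≢u λ ()) ∷ adj-sym G az ∷ [])
      ≢3 : degree G z ≢ 3
      ≢3 dz = <⇒≱ (subst (2 <_) (sym dz) ≤-refl)
                  (twin-degree≤ (adj⇒≢ G az ∘ sym) z≢u (≢u da) (λ ()) (trans dz (sym da)))
      ≢4 : degree G z ≢ 4
      ≢4 dz = z≢u (u-unique z (trans dz (sym du)))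

  -- Two neighbours x, y ≠ u of a would be twins of degree 2, forcing N(x) ⊆ {u, y} ∌ a.
  fullHub-noDegree3 : ∀ a → degree G a ≢ 3
  fullHub-noDegree3 a da with ∃-outside 5 (adj G a) (u ∷ []) (subst (1 <_) (sym da) (<ᵇ⇒< 1 3 tt))
  ... | x , ax , x∉[u] with ∃-outside 5 (adj G a) (u ∷ x ∷ []) (subst (2 <_) (sym da) ≤-refl)
  ... | y , ay , y∉[u,x] = adj⇒≢ G ay
    (twin-neighbour (λ x≡y → y∉[u,x] (there (here (sym x≡y)))) x≢u y≢u (λ ())
       (trans (neighbour-degree≡2 da ax x≢u) (sym (neighbour-degree≡2 da ay y≢u)))
       (adj-sym G ax) (≢u da) (λ ()))
    where
    x≢u = x∉[u] ∘ here
    y≢u = y∉[u,x] ∘ here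

upperAdj : ∀ {V} → Graph V → Fin V → Fin V → Bool
upperAdj G i j = (toℕ i <ᵇ toℕ j) ∧ adj G i j

edgeSum : ∀ {V} → Graph V → ℕ
edgeSum {V} G = ∑[ i < V ] countTrue V (upperAdj G i)

module _ {V} (G : Graph V) where

  adjacency-split : ∀ i j → indicator (adj G i j) ≡ indicator (upperAdj G i j) + indicator (upperAdj G j i)
  adjacency-split i j with toℕ i <ᵇ toℕ j in i<ᵇj | toℕ j <ᵇ toℕ i in j<ᵇi
  ... | true  | true  = contradiction (<ᵇ⇒< (toℕ j) (toℕ i) (subst T (sym j<ᵇi) tt))
                                      (<-asym (<ᵇ⇒< (toℕ i) (toℕ j) (subst T (sym i<ᵇj) tt)))
  ... | true  | false = sym (+-identityʳ _)
  ... | false | true  = cong indicator (Graph.sym G i j)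
  ... | false | false = cong indicator (trans (cong (adj G i) (sym i≡j)) (irrefl G i))
    where
    i≡j : i ≡ j
    i≡j = toℕ-injective (≤-antisym (≮⇒≥ (subst T j<ᵇi ∘ <⇒<ᵇ {toℕ j} {toℕ i}))
                                   (≮⇒≥ (subst T i<ᵇj ∘ <⇒<ᵇ {toℕ i} {toℕ j})))

  handshake : ∑[ i < V ] degree G i ≡ 2 * edgeSum G
  handshake = begin
    ∑[ i < V ] degree G i
      ≡⟨ sum-cong-≗ (λ i → countTrue≡sum V (adj G i)) ⟩
    ∑[ i < V ] ∑[ j < V ] indicator (adj G i j)
      ≡⟨ sum-cong-≗ (λ i → sum-cong-≗ (adjacency-split i)) ⟩
    ∑[ i < V ] ∑[ j < V ] (e i j + e j i)
      ≡⟨ sum-cong-≗ (λ i → ∑-distrib-+ (e i) (λ j → e j i)) ⟩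
    ∑[ i < V ] (∑[ j < V ] e i j + ∑[ j < V ] e j i)
      ≡⟨ ∑-distrib-+ (λ i → ∑[ j < V ] e i j) (λ i → ∑[ j < V ] e j i) ⟩
    S + ∑[ i < V ] ∑[ j < V ] e j i
      ≡⟨ cong (S +_) (trans (∑-comm (λ i j → e j i)) (sym (+-identityʳ S))) ⟩
    2 * S
      ≡⟨ cong (2 *_) (sym (sum-cong-≗ (λ i → countTrue≡sum V (upperAdj G i)))) ⟩
    2 * edgeSum G  ∎
    where
    open ≡-Reasoning
    e : Fin V → Fin V → ℕ
    e i j = indicator (upperAdj G i j)
    S : ℕ
    S = ∑[ i < V ] ∑[ j < V ] e i j

degreeSum₂ : (G : Graph 5) → EqualDegreePath3Free G → RepeatedDegreesAtMost G 2 →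
             ∑[ i < 5 ] degree G i < 12
degreeSum₂ G path3Free repeated≤ with any? (λ u → degree G u ≟ 4)
... | yes (u , du) = ≤-<-trans (sum≤multiplicities (degree G) 5 1 b (degree<V G) bound) (<ᵇ⇒< 10 12 tt)
  where
  open Hub G path3Free u [] (adjacent-to-all G u du)
           (degree-unique G repeated≤ (subst (2 <_) (sym du) (<ᵇ⇒< 2 4 tt)))
  b : ℕ → ℕ
  b 2 = 2
  b 3 = 0
  b _ = 1
  bound : ∀ x → 1 < x → multiplicity (degree G) x ≤ b x
  bound 0 ()
  bound 1 (s≤s ())
  bound 2 _ = multiplicity≤2+length 2 ≤-refl
  bound 3 _ = multiplicity≤-byWitness (degree G) 3 0
    (λ a da → contradiction da (fullHub-noDegree3 G path3Free repeated≤ u du a))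
  bound (suc (suc (suc (suc x)))) _ = multiplicity≤1+length _ (s≤s (s≤s (s≤s z≤n)))
... | no noFull = ≤-<-trans
  (sum≤multiplicities (degree G) 4 2 (λ _ → 1) (degree<-of-noFullVertex G noFull)
                      (multiplicity≤1 G repeated≤))
  (<ᵇ⇒< 11 12 tt)

degreeSum₃ : (G : Graph 7) → EqualDegreePath3Free G → RepeatedDegreesAtMost G 3 →
             ∀ v → 4 < degree G v → ∑[ i < 7 ] degree G i < 24
degreeSum₃ G path3Free repeated≤ v 4<dv with any? (λ u → degree G u ≟ 6)
... | yes (u , du) = ≤-<-trans (sum≤multiplicities (degree G) 7 1 b (degree<V G) bound) (<ᵇ⇒< 23 24 tt)
  where
  open Hub G path3Free u [] (adjacent-to-all G u du)
           (degree-unique G repeated≤ (subst (3 <_) (sym du) (<ᵇ⇒< 3 6 tt)))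
  b : ℕ → ℕ
  b 2 = 2
  b _ = 1
  bound : ∀ x → 1 < x → multiplicity (degree G) x ≤ b x
  bound 0 ()
  bound 1 (s≤s ())
  bound 2 _ = multiplicity≤2+length 2 ≤-refl
  bound (suc (suc (suc x))) _ = multiplicity≤1+length _ (s≤s (s≤s (s≤s z≤n)))
... | no noFull = ≤-<-trans (sum≤multiplicities (degree G) 6 2 b degree<6 bound) (<ᵇ⇒< 22 24 tt)
  where
  degree<6 = degree<-of-noFullVertex G noFull
  dv : degree G v ≡ 5
  dv = ≤-antisym (s≤s⁻¹ (degree<6 v)) 4<dv
  open Hub G path3Free v _ (proj₂ (adjacent-to-all-but-one G v dv))
           (degree-unique G repeated≤ (subst (3 <_) (sym dv) (<ᵇ⇒< 3 5 tt)))
  b : ℕ → ℕ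
  b 3 = 3
  b _ = 1
  bound : ∀ x → 2 < x → multiplicity (degree G) x ≤ b x
  bound 0 ()
  bound 1 (s≤s ())
  bound 2 (s≤s (s≤s ()))
  bound 3 _ = multiplicity≤2+length 3 ≤-refl
  bound (suc (suc (suc (suc x)))) _ = multiplicity≤1 G repeated≤ _ (s≤s (s≤s (s≤s (s≤s z≤n))))

degreeSum₄ : (G : Graph 9) → EqualDegreePath3Free G → RepeatedDegreesAtMost G 4 →
             ∀ v → 6 < degree G v → ∑[ i < 9 ] degree G i < 40
degreeSum₄ G path3Free repeated≤ v 6<dv with any? (λ u → degree G u ≟ 8)
... | yes (u , du) = ≤-<-trans
  (sum≤multiplicities (degree G) 9 2 (λ _ → 1) (degree<V G) multiplicity≤1+length) (<ᵇ⇒< 39 40 tt)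
  where
  open Hub G path3Free u [] (adjacent-to-all G u du)
           (degree-unique G repeated≤ (subst (4 <_) (sym du) (<ᵇ⇒< 4 8 tt)))
... | no noFull = ≤-<-trans (sum≤multiplicities (degree G) 8 2 b degree<8 bound) (<ᵇ⇒< 37 40 tt)
  where
  degree<8 = degree<-of-noFullVertex G noFull
  dv : degree G v ≡ 7
  dv = ≤-antisym (s≤s⁻¹ (degree<8 v)) 6<dv
  open Hub G path3Free v _ (proj₂ (adjacent-to-all-but-one G v dv))
           (degree-unique G repeated≤ (subst (4 <_) (sym dv) (<ᵇ⇒< 4 7 tt)))
  b : ℕ → ℕ
  b 3 = 3
  b 4 = 2
  b _ = 1
  bound : ∀ x → 2 < x → multiplicity (degree G) x ≤ b x
  bound 0 ()
  bound 1 (s≤s ())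
  bound 2 (s≤s (s≤s ()))
  bound 3 _ = multiplicity≤2+length 3 ≤-refl
  bound 4 _ = multiplicity≤1+length 4 ≤-refl
  bound (suc (suc (suc (suc (suc x))))) _ =
    multiplicity≤1 G repeated≤ _ (s≤s (s≤s (s≤s (s≤s (s≤s z≤n)))))

highDegree⇒degreeSum< : ∀ n → n ≡ 2 ⊎ n ≡ 3 ⊎ n ≡ 4 → (G : Graph (2 * n + 1)) →
  EqualDegreePath3Free G → RepeatedDegreesAtMost G n →
  ∀ v → 2 * n ∸ 2 < degree G v → ∑[ i < 2 * n + 1 ] degree G i < 2 * (n * n + n)
highDegree⇒degreeSum< .2 (inj₁ refl)        G path3Free repeated≤ _ _ = degreeSum₂ G path3Free repeated≤
highDegree⇒degreeSum< .3 (inj₂ (inj₁ refl)) G path3Free repeated≤   = degreeSum₃ G path3Free repeated≤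
highDegree⇒degreeSum< .4 (inj₂ (inj₂ refl)) G path3Free repeated≤   = degreeSum₄ G path3Free repeated≤

-- For a numeral V both sides unfold to the same sum; for a variable V they are different functions.
edgeCount≡edgeSum : ∀ n → n ≡ 2 ⊎ n ≡ 3 ⊎ n ≡ 4 → (G : Graph (2 * n + 1)) →
                    edgeCount G ≡ edgeSum G
edgeCount≡edgeSum .2 (inj₁ refl)        G = refl
edgeCount≡edgeSum .3 (inj₂ (inj₁ refl)) G = refl
edgeCount≡edgeSum .4 (inj₂ (inj₂ refl)) G = refl

lemma2p6 : (n : ℕ) → (n ≡ 2 ⊎ n ≡ 3 ⊎ n ≡ 4) →
    (G : Graph (2 * n + 1)) →
    n * n + n ≤ edgeCount G →
    (∀ a b → a ≢ b → degree G a ≡ degree G b → ¬ PathOfLength3 G a b) →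
    (β : ℕ) →
    (Σ (Fin (2 * n + 1)) λ a → Σ (Fin (2 * n + 1)) λ b →
       (a ≢ b) × (degree G a ≡ β) × (degree G b ≡ β)) →
    (∀ a b → a ≢ b → degree G a ≡ degree G b → degree G a ≤ β) →
    β ≤ n →
    ∀ v → degree G v ≤ 2 * n ∸ 2
lemma2p6 n n∈ G edges≥ path3Free β _ repeated≤β β≤n v with degree G v ≤? 2 * n ∸ 2
... | yes Δ≤ = Δ≤
... | no  Δ≰ = contradiction
  (highDegree⇒degreeSum< n n∈ G path3Free repeated≤n v (≰⇒> Δ≰))
  (≤⇒≯ (begin
    2 * (n * n + n)             ≤⟨ *-monoʳ-≤ 2 edges≥ ⟩
    2 * edgeCount G             ≡⟨ cong (2 *_) (edgeCount≡edgeSum n n∈ G) ⟩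
    2 * edgeSum G               ≡⟨ handshake G ⟨
    ∑[ i < 2 * n + 1 ] degree G i  ∎))
  where
  open ≤-Reasoning
  repeated≤n : RepeatedDegreesAtMost G n
  repeated≤n a b a≢b same = ≤-trans (repeated≤β a b a≢b same) β≤n
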